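{- Let $\alpha\ge2$ be an integer and consider a binary search tree, just after construction, in which the weights of any two sibling subtrees differ by at most one, labeled by the $\alpha$-labeling. Let $A$ and $B$ be critical nodes such that $A$ is the critical parent of $B$. Then their (initial) weights satisfy $\max\{(\alpha/2)|B|,\,2|B|-1\}\le |A|\le (2\alpha+1)|B|$.
   Context: The weight $|x|$ of a tree node $x$ is the number of nodes in its subtree plus one (so the weight of a node is the sum of the weights of its two children, an empty subtree having weight $1$). $\alpha$-labeling: a node is critical if for some integer $i\ge0$ either (1) its weight lies between $2\alpha^i$ and $4\alpha^i-2$ inclusive, or (2) its weight is $2\alpha^i-1$ and its sibling's weight is $2\alpha^i$; all other nodes are secondary. (The root is additionally treated as a virtual critical node that need not satisfy these conditions; here $A$ and $B$ are nodes satisfying the conditions.) For a critical node $B$, its critical parent is the nearest proper ancestor of $B$ that is critical. The initial weight of a critical node is its weight at the time it is labeled. -}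

module Defs where

open import Data.Nat using (ℕ; zero; suc; _+_; _*_; _∸_; _^_; _≤_)
open import Data.Maybe using (Maybe; just; nothing)
open import Data.Product using (Σ; ∃; _×_; _,_)
open import Data.Sum using (_⊎_)
open import Relation.Binary.PropositionalEquality using (_≡_)
open import Relation.Nullary using (¬_)
open import Data.Unit using (⊤)

-- Shape of a binary (search) tree; keys are irrelevant to the statement.
-- 'leaf' is an empty subtree, 'node l r' is a node.
data Tree : Set where
  leaf : Tree
  node : Tree → Tree → Tree

-- weight: number of nodes in the subtree plus one
weight : Tree → ℕ
weight leaf       = 1
weight (node l r) = weight l + weight r

Balanced : Tree → Set
Balanced leaf       = ⊤
Balanced (node l r) =
  (weight l ≤ weight r + 1) × (weight r ≤ weight l + 1) × Balanced l × Balanced r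

-- positions (paths from the root) in a tree; may point to empty subtrees
data Pos : Tree → Set where
  here  : ∀ {t} → Pos t
  left  : ∀ {l r} → Pos l → Pos (node l r)
  right : ∀ {l r} → Pos r → Pos (node l r)

subtree : (t : Tree) → Pos t → Tree
subtree t here = t
subtree (node l r) (left p)  = subtree l p
subtree (node l r) (right p) = subtree r p

-- weight of the sibling of the position (nothing for the root),
-- given the sibling weight of the current tree
sibWeight' : (t : Tree) → Maybe ℕ → Pos t → Maybe ℕ
sibWeight' t s here = s
sibWeight' (node l r) s (left p)  = sibWeight' l (just (weight r)) p
sibWeight' (node l r) s (right p) = sibWeight' r (just (weight l)) p

sibWeight : (t : Tree) → Pos t → Maybe ℕ
sibWeight t p = sibWeight' t nothing p

IsNode : Tree → Set
IsNode t = Σ Tree λ l → Σ Tree λ r → t ≡ node l r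

CritCond : ℕ → ℕ → Maybe ℕ → Set
CritCond α w s =
  (∃ λ i → (2 * α ^ i ≤ w) × (w ≤ 4 * α ^ i ∸ 2))
  ⊎ (∃ λ i → (w + 1 ≡ 2 * α ^ i) × (s ≡ just (2 * α ^ i)))

-- a (genuine, non-virtual) critical node
Critical : ℕ → (t : Tree) → Pos t → Set
Critical α t p = IsNode (subtree t p) × CritCond α (weight (subtree t p)) (sibWeight t p)

data _⊏_ : {t : Tree} → Pos t → Pos t → Set where
  here-left   : ∀ {l r} {q : Pos l} → here ⊏ left {l} {r} q
  here-right  : ∀ {l r} {q : Pos r} → here ⊏ right {l} {r} q
  left-left   : ∀ {l r} {p q : Pos l} → p ⊏ q → left {l} {r} p ⊏ left q
  right-right : ∀ {l r} {p q : Pos r} → p ⊏ q → right {l} {r} p ⊏ right q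

CriticalParent : ℕ → (t : Tree) → Pos t → Pos t → Set
CriticalParent α t a b =
  a ⊏ b × Critical α t a × (∀ c → a ⊏ c → c ⊏ b → ¬ Critical α t c)

module Submission where

-- Say a node is at scale Q when it meets the critical condition for Q = α^i;
-- its weight w then lies in the envelope 2Q ≤ 1 + w, 2 + w ≤ 4Q.  Since in a
-- balanced tree a child weighs about half of its parent:
--   (1) a proper ancestor of a node at scale P weighs at least 4P - 1, so a
--       critical one is at a scale at least αP ('scale-above');
--   (2) walking down from a node of weight ≥ 4Q - 1 to one of weight ≤ 2Q - 2
--       meets a node at scale Q strictly in between ('crossing').
-- With B at scale P, (1) gives |A| ≥ 2αP - 1, and (2) for Q = αP forbids
-- |A| > 4αP - 2, as A is the nearest critical ancestor of B.  The theorem is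
-- then arithmetic on the envelopes of P and αP ('critical-parent-envelopes',
-- 'lower-bound', 'upper-bound') plus the balance bound 2|B| ≤ 1 + |A|.

open import Defs
open import Data.Nat using (ℕ; zero; suc; _+_; _*_; _^_; _≤_; _<_; z≤n; s≤s; NonZero; _≤?_)
open import Data.Nat.Properties
open import Data.Nat.Tactic.RingSolver using (solve)
open import Data.List using (_∷_; [])
open import Data.Product using (_×_; _,_; Σ; ∃; proj₁; proj₂)
open import Data.Sum using (_⊎_; inj₁; inj₂)
open import Data.Maybe using (Maybe; just; nothing)
open import Data.Maybe.Properties using (just-injective)
open import Data.Empty using (⊥-elim)
open import Relation.Nullary using (yes; no; contradiction)
open import Relation.Binary.PropositionalEquality using (_≡_; refl; sym; trans; cong; cong₂; subst)

open ≤-Reasoning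

W : {t : Tree} → Pos t → ℕ
W {t} p = weight (subtree t p)

weight-positive : ∀ t → 1 ≤ weight t
weight-positive leaf       = s≤s z≤n
weight-positive (node l r) = ≤-trans (weight-positive l) (m≤m+n (weight l) (weight r))

heavy⇒node : ∀ t → 2 ≤ weight t → IsNode t
heavy⇒node leaf       (s≤s ())
heavy⇒node (node l r) _ = l , r , refl

node⇒heavy : ∀ t → IsNode t → 2 ≤ weight t
node⇒heavy .(node l r) (l , r , refl) = +-mono-≤ (weight-positive l) (weight-positive r)

lighter⇒below-root : ∀ {t} (q : Pos t) → W q < weight t → here ⊏ q
lighter⇒below-root here      lt = ⊥-elim (<-irrefl refl lt)
lighter⇒below-root (left q)  _  = here-left
lighter⇒below-root (right q) _  = here-right

SiblingBound : (t : Tree) → Maybe ℕ → Pos t → ℕ → Set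
SiblingBound t s q m =
  Σ ℕ λ sb → (sibWeight' t s q ≡ just sb) × (W q + sb ≤ m) × (W q ≤ sb + 1)

weaken : ∀ {t s m m'} (q : Pos t) → m ≤ m' → SiblingBound t s q m → SiblingBound t s q m'
weaken _ m≤m' (sb , sib , sum , bal) = sb , sib , ≤-trans sum m≤m' , bal

sibling-within : ∀ t sv (q : Pos t) → Balanced t → weight t ≤ sv + 1 →
  SiblingBound t (just sv) q (weight t + sv)
sibling-within t sv here _ t≤sv+1 = sv , refl , ≤-refl , t≤sv+1
sibling-within (node l r) sv (left q) (l≤r+1 , _ , bal-l , _) _ =
  weaken q (m≤m+n (weight l + weight r) sv) (sibling-within l (weight r) q bal-l l≤r+1)
sibling-within (node l r) sv (right q) (_ , r≤l+1 , _ , bal-r) _ =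
  weaken q (≤-trans (≤-reflexive (+-comm (weight r) (weight l))) (m≤m+n (weight l + weight r) sv))
    (sibling-within r (weight l) q bal-r r≤l+1)

sibling-below : ∀ {t} s {p q : Pos t} → p ⊏ q → Balanced t → SiblingBound t s q (W p)
sibling-below {node l r} _ (here-left {q = q}) (l≤r+1 , _ , bal-l , _) =
  sibling-within l (weight r) q bal-l l≤r+1
sibling-below {node l r} _ (here-right {q = q}) (_ , r≤l+1 , _ , bal-r) =
  weaken q (≤-reflexive (+-comm (weight r) (weight l))) (sibling-within r (weight l) q bal-r r≤l+1)
sibling-below {node l r} _ (left-left p⊏q)   (_ , _ , bal-l , _) = sibling-below (just (weight r)) p⊏q bal-l
sibling-below {node l r} _ (right-right p⊏q) (_ , _ , _ , bal-r) = sibling-below (just (weight l)) p⊏q bal-r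

balanced-half : ∀ w sb m → w + sb ≤ m → w ≤ sb + 1 → 2 * w ≤ 1 + m
balanced-half w sb m sum w≤sb+1 = begin
  2 * w          ≡⟨ solve (w ∷ []) ⟩
  w + w          ≤⟨ +-monoʳ-≤ w w≤sb+1 ⟩
  w + (sb + 1)   ≡⟨ solve (w ∷ sb ∷ []) ⟩
  1 + (w + sb)   ≤⟨ +-monoʳ-≤ 1 sum ⟩
  1 + m          ∎

ancestor-halving : ∀ {t} {p q : Pos t} → p ⊏ q → Balanced t → 2 * W q ≤ 1 + W p
ancestor-halving p⊏q bal with sibling-below nothing p⊏q bal
... | sb , _ , sum , q≤sb+1 = balanced-half _ sb _ sum q≤sb+1

AtScale : ℕ → ℕ → Maybe ℕ → Set
AtScale Q w s = ((2 * Q ≤ w) × (2 + w ≤ 4 * Q))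
              ⊎ ((1 + w ≡ 2 * Q) × (s ≡ just (2 * Q)))

Envelope : ℕ → ℕ → Set
Envelope Q w = (2 * Q ≤ 1 + w) × (2 + w ≤ 4 * Q)

atScale⇒envelope : ∀ Q {w s} → 1 ≤ Q → AtScale Q w s → Envelope Q w
atScale⇒envelope Q _ (inj₁ (low , high)) = ≤-trans low (n≤1+n _) , high
atScale⇒envelope Q {w} 1≤Q (inj₂ (1+w≡2Q , _)) = ≤-reflexive (sym 1+w≡2Q) , (begin
  2 + w       ≡⟨ cong suc 1+w≡2Q ⟩
  1 + 2 * Q   ≤⟨ +-monoˡ-≤ (2 * Q) (≤-trans 1≤Q (m≤m+n Q (Q + 0))) ⟩
  2 * Q + 2 * Q ≡⟨ solve (Q ∷ []) ⟩
  4 * Q       ∎)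

critical⇒atScale : ∀ α .{{_ : NonZero α}} {w s} → CritCond α w s → ∃ λ i → AtScale (α ^ i) w s
critical⇒atScale α {w} (inj₁ (i , low , high)) =
  i , inj₁ (low , subst (_≤ 4 * α ^ i) (+-comm w 2) (m≤o∸n⇒m+n≤o w 2≤4Q high))
  where
  2≤4Q : 2 ≤ 4 * α ^ i
  2≤4Q = ≤-trans (s≤s (s≤s z≤n)) (*-monoʳ-≤ 4 (m^n>0 α i))
critical⇒atScale α {w} (inj₂ (i , w+1≡2Q , sib)) = i , inj₂ (trans (+-comm 1 w) w+1≡2Q , sib)

atScale⇒critical : ∀ α i {w s} → AtScale (α ^ i) w s → CritCond α w s
atScale⇒critical α i {w} (inj₁ (low , high)) =
  inj₁ (i , low , m+n≤o⇒m≤o∸n w (subst (_≤ 4 * α ^ i) (+-comm 2 w) high))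
atScale⇒critical α i {w} (inj₂ (1+w≡2Q , sib)) = inj₂ (i , trans (+-comm w 1) 1+w≡2Q , sib)

ancestor-of-scale : ∀ Q {t} s {p q : Pos t} → p ⊏ q → Balanced t →
  AtScale Q (W q) (sibWeight' t s q) → 4 * Q ≤ 1 + W p
ancestor-of-scale Q s {p} {q} p⊏q bal (inj₁ (2Q≤q , _)) = begin
  4 * Q         ≡⟨ solve (Q ∷ []) ⟩
  2 * (2 * Q)   ≤⟨ *-monoʳ-≤ 2 2Q≤q ⟩
  2 * W q       ≤⟨ ancestor-halving p⊏q bal ⟩
  1 + W p       ∎
ancestor-of-scale Q s {p} {q} p⊏q bal (inj₂ (1+q≡2Q , sib≡2Q)) with sibling-below s p⊏q bal
... | sb , sib≡sb , sum , _ = begin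
  4 * Q          ≡⟨ solve (Q ∷ []) ⟩
  2 * Q + 2 * Q  ≡⟨ cong₂ _+_ (sym 1+q≡2Q) (just-injective (trans (sym sib≡2Q) sib≡sb)) ⟩
  1 + W q + sb   ≤⟨ +-monoʳ-≤ 1 sum ⟩
  1 + W p        ∎

power-gap : ∀ α .{{_ : NonZero α}} j i → α ^ j < α ^ i → α * α ^ j ≤ α ^ i
power-gap α j i lt with i ≤? j
... | yes i≤j = contradiction (^-monoʳ-≤ α i≤j) (<⇒≱ lt)
... | no  i≰j = ^-monoʳ-≤ α (≰⇒> i≰j)

power-one-or-large : ∀ α .{{_ : NonZero α}} j → α ^ j ≡ 1 ⊎ α ≤ α ^ j
power-one-or-large α zero    = inj₁ refl
power-one-or-large α (suc j) = inj₂ (m≤m*n α (α ^ j) {{m^n≢0 α j}})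

-- A node at some scale of the labeling that weighs at least 4P - 1, for a
-- scale P = α^j, weighs at least 2αP - 1: its scale is at least αP.
scale-above : ∀ α .{{_ : NonZero α}} j i {w s} → 4 * α ^ j ≤ 1 + w →
  AtScale (α ^ i) w s → 2 * (α * α ^ j) ≤ 1 + w
scale-above α j i {w} heavy scaled with atScale⇒envelope (α ^ i) (m^n>0 α i) scaled
... | low , high = ≤-trans (*-monoʳ-≤ 2 (power-gap α j i P<Q)) low
  where
  P<Q : α ^ j < α ^ i
  P<Q = *-cancelˡ-< 4 (α ^ j) (α ^ i) (≤-trans (s≤s heavy) high)

half-of-parent : ∀ Q x y → y ≤ x + 1 → 4 * Q ≤ 1 + (x + y) → 2 * Q ≤ 1 + x
half-of-parent Q x y y≤x+1 heavy = *-cancelˡ-≤ 2 (begin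
  2 * (2 * Q)       ≡⟨ solve (Q ∷ []) ⟩
  4 * Q             ≤⟨ heavy ⟩
  1 + (x + y)       ≤⟨ +-monoʳ-≤ 1 (+-monoʳ-≤ x y≤x+1) ⟩
  1 + (x + (x + 1)) ≡⟨ solve (x ∷ []) ⟩
  2 * (1 + x)       ∎)

child-step : ∀ Q x y → y ≤ x + 1 → 4 * Q ≤ 1 + (x + y) → AtScale Q x (just y) ⊎ 4 * Q ≤ 1 + x
child-step Q x y y≤x+1 heavy with m≤n⇒m<n∨m≡n (half-of-parent Q x y y≤x+1 heavy)
... | inj₂ 2Q≡1+x = inj₁ (inj₂ (sym 2Q≡1+x , cong just y≡2Q))
  where
  y≡2Q : y ≡ 2 * Q
  y≡2Q = ≤-antisym (subst (y ≤_) (trans (+-comm x 1) (sym 2Q≡1+x)) y≤x+1)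
    (+-cancelˡ-≤ (2 * Q) (2 * Q) y (begin
      2 * Q + 2 * Q   ≡⟨ solve (Q ∷ []) ⟩
      4 * Q           ≤⟨ heavy ⟩
      1 + (x + y)     ≡⟨ sym (+-assoc 1 x y) ⟩
      (1 + x) + y     ≡⟨ cong (_+ y) (sym 2Q≡1+x) ⟩
      2 * Q + y       ∎))
... | inj₁ (s≤s 2Q≤x) with 2 + x ≤? 4 * Q
...   | yes fits      = inj₁ (inj₁ (2Q≤x , fits))
...   | no  too-heavy = inj₂ (≤-pred (≰⇒> too-heavy))

crossing : ∀ Q {t} s {p q : Pos t} → p ⊏ q → Balanced t → 4 * Q ≤ 1 + W p → 2 + W q ≤ 2 * Q →
  Σ (Pos t) λ c → p ⊏ c × c ⊏ q × AtScale Q (W c) (sibWeight' t s c)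

-- The first step of the walk: it enters a child u, balanced against its
-- sibling of weight sv; the node met may be u itself.
crossing-child : ∀ Q {u} sv (q : Pos u) → Balanced u → sv ≤ weight u + 1 →
  4 * Q ≤ 1 + (weight u + sv) → 2 + W q ≤ 2 * Q →
  Σ (Pos u) λ c → c ⊏ q × AtScale Q (W c) (sibWeight' u (just sv) c)
crossing-child Q {u} sv q bal sv≤u+1 heavy light
  with lighter⇒below-root q (≤-pred (≤-trans light (half-of-parent Q (weight u) sv sv≤u+1 heavy)))
     | child-step Q (weight u) sv sv≤u+1 heavy
... | q-below | inj₁ scaled  = here , q-below , scaled
... | q-below | inj₂ heavy-u with crossing Q (just sv) q-below bal heavy-u light
...   | c , _ , c⊏q , scaled = c , c⊏q , scaled

crossing Q {node l r} _ (here-left {q = q}) (_ , r≤l+1 , bal-l , _) heavy light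
  with crossing-child Q (weight r) q bal-l r≤l+1 heavy light
... | c , c⊏q , scaled = left c , here-left , left-left c⊏q , scaled
crossing Q {node l r} _ (here-right {q = q}) (l≤r+1 , _ , _ , bal-r) heavy light
  with crossing-child Q (weight l) q bal-r l≤r+1
      (subst (λ w → 4 * Q ≤ 1 + w) (+-comm (weight l) (weight r)) heavy) light
... | c , c⊏q , scaled = right c , here-right , right-right c⊏q , scaled
crossing Q {node l r} _ (left-left p⊏q) (_ , _ , bal-l , _) heavy light
  with crossing Q (just (weight r)) p⊏q bal-l heavy light
... | c , p⊏c , c⊏q , scaled = left c , left-left p⊏c , left-left c⊏q , scaled
crossing Q {node l r} _ (right-right p⊏q) (_ , _ , _ , bal-r) heavy light
  with crossing Q (just (weight l)) p⊏q bal-r heavy light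
... | c , p⊏c , c⊏q , scaled = right c , right-right p⊏c , right-right c⊏q , scaled

critical-parent-envelopes : ∀ α .{{_ : NonZero α}} → 2 ≤ α → ∀ t → Balanced t → (a b : Pos t) →
  Critical α t b → CriticalParent α t a b →
  ∃ λ j → Envelope (α ^ j) (W b) × Envelope (α * α ^ j) (W a)
critical-parent-envelopes α 2≤α t bal a b (_ , b-crit) (a⊏b , (_ , a-crit) , nearest)
  with critical⇒atScale α b-crit | critical⇒atScale α a-crit
... | j , b-scaled | i , a-scaled = j , b-envelope , (a-low , a-high)
  where
  P Q : ℕ
  P = α ^ j
  Q = α * P
  b-envelope : Envelope P (W b)
  b-envelope = atScale⇒envelope P (m^n>0 α j) b-scaled
  -- A is at scale at least αP, since it is an ancestor of B.
  a-low : 2 * Q ≤ 1 + W a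
  a-low = scale-above α j i (ancestor-of-scale P nothing a⊏b bal b-scaled) a-scaled
  2≤Q : 2 ≤ Q
  2≤Q = ≤-trans 2≤α (m≤m*n α P {{m^n≢0 α j}})
  b-light : 2 + W b ≤ 2 * Q
  b-light = begin
    2 + W b     ≤⟨ proj₂ b-envelope ⟩
    4 * P       ≡⟨ *-assoc 2 2 P ⟩
    2 * (2 * P) ≤⟨ *-monoʳ-≤ 2 (*-monoˡ-≤ P 2≤α) ⟩
    2 * Q       ∎
  -- A heavier A would have a critical node at scale αP strictly below it
  -- and strictly above B, contradicting that A is the critical parent.
  a-high : 2 + W a ≤ 4 * Q
  a-high with 2 + W a ≤? 4 * Q
  ... | yes fits = fits
  ... | no too-heavy with crossing Q nothing a⊏b bal (≤-pred (≰⇒> too-heavy)) b-light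
  ...   | c , a⊏c , c⊏b , c-scaled =
    contradiction (heavy⇒node _ c-heavy , atScale⇒critical α (suc j) c-scaled) (nearest c a⊏c c⊏b)
    where
    c-low : 2 * Q ≤ 1 + W c
    c-low = proj₁ (atScale⇒envelope Q (≤-trans (s≤s z≤n) 2≤Q) c-scaled)
    c-heavy : 2 ≤ W c
    c-heavy = <⇒≤ (≤-pred (≤-trans (*-monoʳ-≤ 2 2≤Q) c-low))

lower-bound : ∀ α P B A → 2 ≤ α → 2 + B ≤ 4 * P → 2 * (α * P) ≤ 1 + A → α * B ≤ 2 * A
lower-bound α P B A 2≤α b-high a-low = +-cancelˡ-≤ 2 (α * B) (2 * A) (begin
  2 + α * B           ≤⟨ +-monoˡ-≤ (α * B) (≤-trans 2≤α (m≤n*m α 2)) ⟩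
  2 * α + α * B       ≡⟨ solve (α ∷ B ∷ []) ⟩
  α * (2 + B)         ≤⟨ *-monoʳ-≤ α b-high ⟩
  α * (4 * P)         ≡⟨ solve (α ∷ P ∷ []) ⟩
  2 * (2 * (α * P))   ≤⟨ *-monoʳ-≤ 2 a-low ⟩
  2 * (1 + A)         ≡⟨ solve (A ∷ []) ⟩
  2 + 2 * A           ∎)

upper-bound : ∀ α P B A → P ≡ 1 ⊎ α ≤ P → 2 ≤ B → 2 * P ≤ 1 + B → 2 + A ≤ 4 * (α * P) →
  A ≤ (2 * α + 1) * B
upper-bound α .1 B A (inj₁ refl) 2≤B _ a-high = begin
  A                 ≤⟨ m≤n+m A 2 ⟩
  2 + A             ≤⟨ a-high ⟩
  4 * (α * 1)       ≤⟨ m≤m+n (4 * (α * 1)) 2 ⟩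
  4 * (α * 1) + 2   ≡⟨ solve (α ∷ []) ⟩
  (2 * α + 1) * 2   ≤⟨ *-monoʳ-≤ (2 * α + 1) 2≤B ⟩
  (2 * α + 1) * B   ∎
upper-bound α P B A (inj₂ α≤P) _ b-low a-high = ≤-pred (≤-trans (n≤1+n (1 + A)) (begin
  2 + A                   ≤⟨ a-high ⟩
  4 * (α * P)             ≡⟨ solve (α ∷ P ∷ []) ⟩
  (2 * α) * (2 * P)       ≤⟨ *-monoʳ-≤ (2 * α) b-low ⟩
  (2 * α) * (1 + B)       ≡⟨ solve (α ∷ B ∷ []) ⟩
  2 * α + 2 * α * B       ≤⟨ +-monoˡ-≤ (2 * α * B) (≤-trans (*-monoʳ-≤ 2 α≤P) b-low) ⟩
  (1 + B) + 2 * α * B     ≡⟨ solve (α ∷ B ∷ []) ⟩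
  1 + (2 * α + 1) * B     ∎))

lemma5 : (α : ℕ) → 2 ≤ α → (t : Tree) → Balanced t → (a b : Pos t) →
    Critical α t b → CriticalParent α t a b →
    (α * weight (subtree t b) ≤ 2 * weight (subtree t a))
    × (2 * weight (subtree t b) ≤ weight (subtree t a) + 1)
    × (weight (subtree t a) ≤ (2 * α + 1) * weight (subtree t b))
lemma5 zero ()
lemma5 α@(suc _) 2≤α t bal a b b-critical a-parent@(a⊏b , _)
  with critical-parent-envelopes α 2≤α t bal a b b-critical a-parent
... | j , (b-low , b-high) , (a-low , a-high) =
    lower-bound α (α ^ j) (W b) (W a) 2≤α b-high a-low
  , subst (2 * W b ≤_) (+-comm 1 (W a)) (ancestor-halving a⊏b bal)
  , upper-bound α (α ^ j) (W b) (W a) (power-one-or-large α j)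
      (node⇒heavy _ (proj₁ b-critical)) b-low a-high
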